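{- Let $X$ be a permutation of $[n]$ that is a preorder traversal of a binary search tree on $[n]$ (equivalently, $X$ avoids $(2,3,1)$), and let $T$ be any initial binary search tree on $[n]$. Then $|G_S(X)|\le |G(X)|$, where both executions start from $T$.
   Context: For $X=(x_1,\dots,x_n)$, $\mathcal T_X$ is the BST obtained by inserting $x_1,\dots,x_n$ in order into an empty tree, and $I_{x_i}$ is the minimal open interval with integer endpoints containing all keys of the subtree of $\mathcal T_X$ rooted at $x_i$. $T$ is encoded by a fixed point set in rows $-(n-1),\dots,0$ (standard geometric encoding; each column contains a point). For a key $a$ and time $t$, $\tau(a,t)$ is the last row $<t$ containing a point in column $a$. Greedy (search), $G(X)$: for $t=1,\dots,n$, add $(a,t)$ for every key $a\in[n]$ such that the closed rectangle with corners $(a,\tau(a,t))$ and $(x_t,t)$ contains no point other than these two; $G(X)$ is the set of points added in rows $1,\dots,n$. Greedy in the split model, $G_S(X)$: the same, except that at time $i$ only keys $a\in I_{x_i}$ are considered. -}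

module Defs where

open import Data.Nat using (ℕ; zero; suc; _+_; _∸_; _⊔_; _⊓_; _≤_; _≡ᵇ_) renaming (_≤ᵇ_ to _≤ℕᵇ_)
open import Data.Integer using (ℤ; +_; -_) renaming (_≤ᵇ_ to _≤ℤᵇ_)
open import Data.Bool using (Bool; true; false; _∧_; _∨_; not; if_then_else_)
open import Data.List using (List; []; _∷_; _++_; map; upTo; filterᵇ; length; last)
open import Data.Maybe using (Maybe; just; nothing)
open import Data.Product using (_×_; _,_; Σ)
open import Relation.Binary.PropositionalEquality using (_≡_)

data Tree : Set where
  leaf : Tree
  node : Tree → ℕ → Tree → Tree

inorder : Tree → List ℕ
inorder leaf = []
inorder (node l k r) = inorder l ++ (k ∷ inorder r)

preorder : Tree → List ℕ
preorder leaf = []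
preorder (node l k r) = k ∷ (preorder l ++ preorder r)

-- range l r = [l, l+1, ..., r]  (empty if r < l)
range : ℕ → ℕ → List ℕ
range l r = map (λ i → l + i) (upTo (suc r ∸ l))

keys : ℕ → List ℕ
keys n = range 1 n

IsBSTOn : ℕ → Tree → Set
IsBSTOn n T = inorder T ≡ keys n

IsPreorderOfBST : ℕ → List ℕ → Set
IsPreorderOfBST n X = Σ Tree (λ S → IsBSTOn n S × preorder S ≡ X)

insert : ℕ → Tree → Tree
insert x leaf = node leaf x leaf
insert x (node l k r) =
  if x ≡ᵇ k then node l k r
  else (if x ≤ℕᵇ k then node (insert x l) k r else node l k (insert x r))

buildAux : Tree → List ℕ → Tree
buildAux t [] = t
buildAux t (x ∷ xs) = buildAux (insert x t) xs

bstOf : List ℕ → Tree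
bstOf = buildAux leaf

subtreeAt : ℕ → Tree → Tree
subtreeAt x leaf = leaf
subtreeAt x (node l k r) =
  if x ≡ᵇ k then node l k r
  else (if x ≤ℕᵇ k then subtreeAt x l else subtreeAt x r)

minKey : Tree → ℕ
minKey t with inorder t
... | [] = 0
... | k ∷ _ = k

maxKey : Tree → ℕ
maxKey t with last (inorder t)
... | nothing = 0
... | just k = k

-- Keys of [n] lying in I_x: I_x = (minKey - 1, maxKey + 1) for the subtree of
-- T_X rooted at x, so the integer keys in it are minKey, ..., maxKey.
keysInI : List ℕ → ℕ → List ℕ
keysInI X x = range (minKey (subtreeAt x (bstOf X))) (maxKey (subtreeAt x (bstOf X)))

-- Geometric encoding of the initial tree:
-- key a at depth d (root has depth 0) is the point (a, -d); rows -(n-1),...,0.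

Point : Set
Point = ℕ × ℤ

depthPoints : ℕ → Tree → List Point
depthPoints d leaf = []
depthPoints d (node l k r) = (k , - (+ d)) ∷ (depthPoints (suc d) l ++ depthPoints (suc d) r)

initialPoints : Tree → List Point
initialPoints = depthPoints 0

_≡ℤᵇ_ : ℤ → ℤ → Bool
i ≡ℤᵇ j = (i ≤ℤᵇ j) ∧ (j ≤ℤᵇ i)

_<ℤᵇ_ : ℤ → ℤ → Bool
i <ℤᵇ j = not (j ≤ℤᵇ i)

maxℤ : ℤ → ℤ → ℤ
maxℤ i j = if i ≤ℤᵇ j then j else i

allB : {A : Set} → (A → Bool) → List A → Bool
allB p [] = true
allB p (x ∷ xs) = p x ∧ allB p xs

-- τ(a,t): last row < t containing a point of P in column a
tau : List Point → ℕ → ℤ → Maybe ℤ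
tau [] a t = nothing
tau ((c , r) ∷ P) a t with tau P a t
... | nothing = if (c ≡ᵇ a) ∧ (r <ℤᵇ t) then just r else nothing
... | just s = if (c ≡ᵇ a) ∧ (r <ℤᵇ t) then just (maxℤ r s) else just s

inRect : ℕ → ℤ → ℕ → ℤ → Point → Bool
inRect a s x t (c , r) =
  ((a ⊓ x) ≤ℕᵇ c) ∧ (c ≤ℕᵇ (a ⊔ x)) ∧ (s ≤ℤᵇ r) ∧ (r ≤ℤᵇ t)

samePt : Point → Point → Bool
samePt (c , r) (c' , r') = (c ≡ᵇ c') ∧ (r ≡ℤᵇ r')

-- key a is touched at time t (access x) given the current point set P:
-- the rectangle between (a, τ(a,t)) and (x, t) contains no point of
-- P ∪ {(x,t)} other than these two corners.
touched : List Point → ℕ → ℤ → ℕ → Bool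
touched P x t a with tau P a t
... | nothing = false
... | just s = allB (λ p → not (inRect a s x t p) ∨ samePt p (a , s) ∨ samePt p (x , t)) ((x , t) ∷ P)

-- run cand P t X : points added at rows t, t+1, ... when accessing X,
-- where at the access of key x only the keys in cand x are considered.
run : (ℕ → List ℕ) → List Point → ℕ → List ℕ → List Point
run cand P t [] = []
run cand P t (x ∷ xs) =
  let new = map (λ a → (a , + t)) (filterᵇ (touched P x (+ t)) (cand x))
  in new ++ run cand (new ++ P) (suc t) xs

-- G(X), started from initial tree T (rows 1..n)
greedy : ℕ → List ℕ → Tree → List Point
greedy n X T = run (λ _ → keys n) (initialPoints T) 1 X

-- G_S(X), started from initial tree T: at time i only keys in I_{x_i}
greedySplit : ℕ → List ℕ → Tree → List Point
greedySplit n X T = run (keysInI X) (initialPoints T) 1 X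

-- Induction on the search tree S with preorder X. When the root k of a subtree
-- with key interval I = I_k is accessed, the two executions agree on the
-- columns of I; whether a key c of I is touched depends only on the columns
-- between c and k, so the split run touches exactly the keys of I that the full
-- run touches there. After this access the point (k, t) lies above every point
-- right of k, so while the left subtree (keys < k) is served the full run never
-- touches a column right of k, and the split run stays inside the left interval.
-- Hence the two executions still agree on the right interval when the right
-- subtree is served, and summing the per-access inequalities proves the claim.

module Submission where

open import Defs
open import Data.Nat using (ℕ; _≤_)
open import Data.List using (List; length)
open import Data.Bool using (Bool; true; false; T; not; _∧_; _∨_; if_then_else_)
open import Data.Bool.Properties using (T-≡; T-∧; T-∨)
open import Data.Empty using (⊥-elim)
open import Data.Integer as Z using (ℤ; +_) renaming (_≤ᵇ_ to _≤ℤᵇ_)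
import Data.Integer.Properties as ℤ
open import Data.List using ([]; _∷_; _++_; map; upTo; applyUpTo; last; filterᵇ)
open import Data.List.Properties using (map-applyUpTo; ∷-injective; ++-assoc; length-++; length-map)
open import Data.List.Membership.Propositional using (_∈_)
open import Data.List.Membership.Propositional.Properties
  using (∈-++⁺ˡ; ∈-++⁺ʳ; ∈-++⁻; ∈-map⁺; ∈-map⁻; ∈-filter⁺; ∈-filter⁻)
open import Data.List.Relation.Binary.Sublist.Propositional using (_⊆_; _∷ʳ_; ⊆-refl; ⊆-reflexive; ⊆-trans; lookup)
import Data.List.Relation.Binary.Sublist.Propositional.Properties as Sublist
open import Data.List.Relation.Unary.All as All using (All; []; _∷_)
open import Data.List.Relation.Unary.Any using (here; there)
open import Data.Maybe using (Maybe; just; nothing)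
open import Data.Nat using (zero; suc; _+_; _∸_; _⊓_; _⊔_; _<_; _≡ᵇ_; z≤n; s≤s) renaming (_≤ᵇ_ to _≤ℕᵇ_)
open import Data.Nat.Properties as ℕ using (+-suc; +-identityʳ)
open import Data.Product using (∃; _×_; _,_; proj₁; proj₂; map₂)
open import Data.Product.Properties using (,-injectiveˡ)
open import Data.Sum as Sum using (_⊎_; inj₁; inj₂)
open import Data.Unit using (⊤; tt)
open import Function using (_⇔_; mk⇔; Equivalence; id; _∘_; case_of_)
import Function.Properties.Equivalence as ⇔
open import Relation.Nullary using (¬_; yes; no)
open import Relation.Nullary.Decidable using (T?)
open import Relation.Binary.PropositionalEquality hiding (preorder)

open Equivalence using (to; from)

T-injective : ∀ {b b′} → (T b → T b′) → (T b′ → T b) → b ≡ b′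
T-injective {false} {false} _ _ = refl
T-injective {false} {true}  _ g = ⊥-elim (g _)
T-injective {true}  {false} f _ = ⊥-elim (f _)
T-injective {true}  {true}  _ _ = refl

filterᵇ-cong-∈ : ∀ {A : Set} {p q : A → Bool} xs →
  (∀ {x} → x ∈ xs → p x ≡ q x) → filterᵇ p xs ≡ filterᵇ q xs
filterᵇ-cong-∈ []       _   = refl
filterᵇ-cong-∈ {p = p} {q} (x ∷ xs) p≡q with p x | q x | p≡q (here refl) | filterᵇ-cong-∈ xs (p≡q ∘ there)
... | true  | .true  | refl | ih = cong (x ∷_) ih
... | false | .false | refl | ih = ih

seg : ℕ → ℕ → List ℕ
seg lo zero    = []
seg lo (suc m) = lo ∷ seg (suc lo) m

applyUpTo-seg : ∀ {lo} (f : ℕ → ℕ) m → (∀ i → f i ≡ lo + i) → applyUpTo f m ≡ seg lo m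
applyUpTo-seg     f zero    _  = refl
applyUpTo-seg {lo} f (suc m) eq =
  cong₂ _∷_ (trans (eq 0) (+-identityʳ lo))
            (applyUpTo-seg (λ i → f (suc i)) m (λ i → trans (eq (suc i)) (+-suc lo i)))

map-+-upTo : ∀ lo m → map (λ i → lo + i) (upTo m) ≡ seg lo m
map-+-upTo lo m = trans (map-applyUpTo (λ i → i) (λ i → lo + i) m) (applyUpTo-seg (λ i → lo + i) m (λ _ → refl))

keys≡seg : ∀ n → keys n ≡ seg 1 n
keys≡seg = map-+-upTo 1

range≡seg : ∀ lo m → range lo (lo + m) ≡ seg lo (suc m)
range≡seg lo m = trans (map-+-upTo lo _)
  (cong (seg lo) (trans (cong (_∸ lo) (sym (+-suc lo m))) (ℕ.m+n∸m≡n lo (suc m))))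

seg-++ : ∀ lo a b → seg lo (a + b) ≡ seg lo a ++ seg (lo + a) b
seg-++ lo zero    b = cong (λ l → seg l b) (sym (+-identityʳ lo))
seg-++ lo (suc a) b =
  cong (lo ∷_) (trans (seg-++ (suc lo) a b) (cong (λ l → seg (suc lo) a ++ seg l b) (sym (+-suc lo a))))

seg-split : ∀ lo a b → seg lo (suc (a + b)) ≡ seg lo a ++ (lo + a) ∷ seg (suc (lo + a)) b
seg-split lo a b = trans (cong (seg lo) (sym (+-suc a b))) (seg-++ lo a (suc b))

∈-seg⇔ : ∀ {c lo m} → c ∈ seg lo m ⇔ (lo ≤ c × c < lo + m)
∈-seg⇔ = mk⇔ ∈-seg⁻ ∈-seg⁺
  where
  ∈-seg⁻ : ∀ {c lo m} → c ∈ seg lo m → lo ≤ c × c < lo + m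
  ∈-seg⁻ {lo = lo} {suc m} (here refl) = ℕ.≤-refl , ℕ.m<m+n lo (s≤s z≤n)
  ∈-seg⁻ {c} {lo} {suc m} (there c∈) with ∈-seg⁻ c∈
  ... | lo<c , c<hi = ℕ.<⇒≤ lo<c , subst (c <_) (sym (+-suc lo m)) c<hi
  ∈-seg⁺ : ∀ {c lo m} → lo ≤ c × c < lo + m → c ∈ seg lo m
  ∈-seg⁺ {lo = lo} {zero}  (lo≤c , c<lo) = ⊥-elim (ℕ.<⇒≱ c<lo (subst (_≤ _) (sym (+-identityʳ lo)) lo≤c))
  ∈-seg⁺ {c} {lo} {suc m} (lo≤c , c<hi) with ℕ.m≤n⇒m<n∨m≡n lo≤c
  ... | inj₁ lo<c = there (∈-seg⁺ (lo<c , subst (c <_) (+-suc lo m) c<hi))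
  ... | inj₂ refl = here refl

last-seg : ∀ lo m → last (seg lo (suc m)) ≡ just (lo + m)
last-seg lo zero    = cong just (sym (+-identityʳ lo))
last-seg lo (suc m) = trans (last-seg (suc lo) m) (cong just (sym (+-suc lo m)))

seg-⊆ˡ : ∀ lo a b → seg lo a ⊆ seg lo (suc (a + b))
seg-⊆ˡ lo a b = subst (seg lo a ⊆_) (sym (seg-split lo a b)) (Sublist.++⁺ʳ _ ⊆-refl)

seg-⊆ʳ : ∀ lo a b → seg (suc (lo + a)) b ⊆ seg lo (suc (a + b))
seg-⊆ʳ lo a b =
  subst (seg (suc (lo + a)) b ⊆_) (sym (seg-split lo a b)) (Sublist.++⁺ˡ (seg lo a) ((lo + a) ∷ʳ ⊆-refl))

split-∈-seg : ∀ lo a b → lo + a ∈ seg lo (suc (a + b))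
split-∈-seg lo a b = subst (lo + a ∈_) (sym (seg-split lo a b)) (∈-++⁺ʳ (seg lo a) (here refl))

-- BST lo m S : S is a search tree with key set lo, lo+1, ..., lo+m-1
data BST : ℕ → ℕ → Tree → Set where
  leaf : ∀ {lo} → BST lo 0 leaf
  node : ∀ {lo a b l r} → BST lo a l → BST (suc (lo + a)) b r →
         BST lo (suc (a + b)) (node l (lo + a) r)

inorder-BST : ∀ {lo m S} → BST lo m S → inorder S ≡ seg lo m
inorder-BST leaf = refl
inorder-BST {lo} (node {a = a} {b} dl dr) =
  trans (cong₂ (λ xs ys → xs ++ (lo + a) ∷ ys) (inorder-BST dl) (inorder-BST dr)) (sym (seg-split lo a b))

++-∷-≡-seg : ∀ xs {k ys lo m} → xs ++ k ∷ ys ≡ seg lo m →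
  ∃ λ b → m ≡ suc (length xs + b) × xs ≡ seg lo (length xs) × k ≡ lo + length xs × ys ≡ seg (suc k) b
++-∷-≡-seg []       {m = suc m} e with ∷-injective e
... | refl , ys≡ = m , refl , refl , sym (+-identityʳ _) , ys≡
++-∷-≡-seg (x ∷ xs) {m = suc m} e with ∷-injective e
... | refl , e′ with ++-∷-≡-seg xs e′
...   | b , refl , xs≡ , k≡ , ys≡ = b , refl , cong (x ∷_) xs≡ , trans k≡ (sym (+-suc x (length xs))) , ys≡

BST-inorder : ∀ S {lo m} → inorder S ≡ seg lo m → BST lo m S
BST-inorder leaf {m = zero} _ = leaf
BST-inorder (node l k r) e with ++-∷-≡-seg (inorder l) e
... | b , refl , l≡ , refl , r≡ = node (BST-inorder l l≡) (BST-inorder r r≡)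

∈-preorder-BST : ∀ {lo m S x} → BST lo m S → x ∈ preorder S → x ∈ seg lo m
∈-preorder-BST {lo} (node {a = a} {b} dl dr) (here refl) = split-∈-seg lo a b
∈-preorder-BST {lo} (node {a = a} {b} {l} dl dr) (there x∈) with ∈-++⁻ (preorder l) x∈
... | inj₁ x∈l = lookup (seg-⊆ˡ lo a b) (∈-preorder-BST dl x∈l)
... | inj₂ x∈r = lookup (seg-⊆ʳ lo a b) (∈-preorder-BST dr x∈r)

branch : {A : Set} → ℕ → ℕ → A → A → A → A
branch x k eq lt gt = if x ≡ᵇ k then eq else (if x ≤ℕᵇ k then lt else gt)

module _ {A : Set} {eq lt gt : A} where

  branch-≡ : ∀ k → branch k k eq lt gt ≡ eq
  branch-≡ k with k ≡ᵇ k in e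
  ... | true  = refl
  ... | false = ⊥-elim (subst T e (ℕ.≡⇒≡ᵇ k k refl))

  branch-< : ∀ {x k} → x < k → branch x k eq lt gt ≡ lt
  branch-< {x} {k} x<k with x ≡ᵇ k in e
  ... | true  = ⊥-elim (ℕ.<⇒≢ x<k (ℕ.≡ᵇ⇒≡ x k (from T-≡ e)))
  ... | false with x ≤ℕᵇ k in e′
  ...   | true  = refl
  ...   | false = ⊥-elim (subst T e′ (ℕ.≤⇒≤ᵇ (ℕ.<⇒≤ x<k)))

  branch-> : ∀ {x k} → k < x → branch x k eq lt gt ≡ gt
  branch-> {x} {k} k<x with x ≡ᵇ k in e
  ... | true  = ⊥-elim (ℕ.<⇒≢ k<x (sym (ℕ.≡ᵇ⇒≡ x k (from T-≡ e))))
  ... | false with x ≤ℕᵇ k in e′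
  ...   | true  = ⊥-elim (ℕ.<⇒≱ k<x (ℕ.≤ᵇ⇒≤ x k (from T-≡ e′)))
  ...   | false = refl

buildAux-left : ∀ {l k r xs} → All (_< k) xs → buildAux (node l k r) xs ≡ node (buildAux l xs) k r
buildAux-left [] = refl
buildAux-left {l} {k} {r} {x ∷ xs} (x<k ∷ xs<k) =
  trans (cong (λ t → buildAux t xs) (branch-< x<k)) (buildAux-left xs<k)

buildAux-right : ∀ {l k r xs} → All (k <_) xs → buildAux (node l k r) xs ≡ node l k (buildAux r xs)
buildAux-right [] = refl
buildAux-right {l} {k} {r} {x ∷ xs} (k<x ∷ k<xs) =
  trans (cong (λ t → buildAux t xs) (branch-> k<x)) (buildAux-right k<xs)

buildAux-++ : ∀ t xs ys → buildAux t (xs ++ ys) ≡ buildAux (buildAux t xs) ys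
buildAux-++ t []       ys = refl
buildAux-++ t (x ∷ xs) ys = buildAux-++ (insert x t) xs ys

bstOf-preorder : ∀ {lo m S} → BST lo m S → bstOf (preorder S) ≡ S
bstOf-preorder leaf = refl
bstOf-preorder {lo} (node {a = a} {l = l} {r} dl dr) = begin
  buildAux (node leaf k leaf) (preorder l ++ preorder r)
    ≡⟨ buildAux-++ _ (preorder l) (preorder r) ⟩
  buildAux (buildAux (node leaf k leaf) (preorder l)) (preorder r)
    ≡⟨ cong (λ t → buildAux t (preorder r)) (buildAux-left (All.tabulate (proj₂ ∘ keyBounds dl))) ⟩
  buildAux (node (bstOf (preorder l)) k leaf) (preorder r)
    ≡⟨ cong (λ t → buildAux (node t k leaf) (preorder r)) (bstOf-preorder dl) ⟩
  buildAux (node l k leaf) (preorder r)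
    ≡⟨ buildAux-right (All.tabulate (proj₁ ∘ keyBounds dr)) ⟩
  node l k (bstOf (preorder r))
    ≡⟨ cong (node l k) (bstOf-preorder dr) ⟩
  node l k r ∎
  where
  open ≡-Reasoning
  k = lo + a
  keyBounds : ∀ {lo′ m′ S′ x} → BST lo′ m′ S′ → x ∈ preorder S′ → lo′ ≤ x × x < lo′ + m′
  keyBounds d x∈ = to ∈-seg⇔ (∈-preorder-BST d x∈)

minKey-seg : ∀ t {lo m} → inorder t ≡ seg lo (suc m) → minKey t ≡ lo
minKey-seg t e with inorder t
minKey-seg t refl | ._ = refl

maxKey-seg : ∀ t {lo m} → inorder t ≡ seg lo (suc m) → maxKey t ≡ lo + m
maxKey-seg t {lo} {m} e with last (inorder t) | trans (cong last e) (last-seg lo m)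
... | just k | refl = refl

range-minKey-maxKey : ∀ {lo m S} → BST lo (suc m) S → range (minKey S) (maxKey S) ≡ seg lo (suc m)
range-minKey-maxKey {lo} {m} {S} d =
  trans (cong₂ range (minKey-seg S (inorder-BST d)) (maxKey-seg S (inorder-BST d))) (range≡seg lo m)

subtreeInterval : Tree → ℕ → List ℕ
subtreeInterval R x = range (minKey (subtreeAt x R)) (maxKey (subtreeAt x R))

SubtreeIntervals : (ℕ → List ℕ) → ∀ {lo m S} → BST lo m S → Set
SubtreeIntervals cand leaf = ⊤
SubtreeIntervals cand (node {lo} {a} {b} dl dr) =
  cand (lo + a) ≡ seg lo (suc (a + b)) × SubtreeIntervals cand dl × SubtreeIntervals cand dr

subtreeInterval-intervals : ∀ R {lo m S} (D : BST lo m S) →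
  (∀ {x} → x ∈ seg lo m → subtreeAt x R ≡ subtreeAt x S) → SubtreeIntervals (subtreeInterval R) D
subtreeInterval-intervals R leaf _ = tt
subtreeInterval-intervals R {lo} (node {a = a} {b} {l} {r} dl dr) same =
  root , subtreeInterval-intervals R dl sameˡ , subtreeInterval-intervals R dr sameʳ
  where
  k = lo + a
  S = node l k r
  root : subtreeInterval R k ≡ seg lo (suc (a + b))
  root = trans (cong (λ t → range (minKey t) (maxKey t)) (trans (same (split-∈-seg lo a b)) (branch-≡ k)))
               (range-minKey-maxKey (node dl dr))
  sameˡ : ∀ {x} → x ∈ seg lo a → subtreeAt x R ≡ subtreeAt x l
  sameˡ x∈ = trans (same (lookup (seg-⊆ˡ lo a b) x∈)) (branch-< (proj₂ (to ∈-seg⇔ x∈)))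
  sameʳ : ∀ {x} → x ∈ seg (suc k) b → subtreeAt x R ≡ subtreeAt x r
  sameʳ x∈ = trans (same (lookup (seg-⊆ʳ lo a b) x∈)) (branch-> (proj₁ (to ∈-seg⇔ x∈)))

IsTau : List Point → ℕ → ℤ → Maybe ℤ → Set
IsTau P a t nothing  = ∀ {r} → (a , r) ∈ P → ¬ r Z.< t
IsTau P a t (just s) = (a , s) ∈ P × s Z.< t × (∀ {r} → (a , r) ∈ P → r Z.< t → r Z.≤ s)

T-<ℤᵇ : ∀ {r t} → T (r <ℤᵇ t) ⇔ r Z.< t
T-<ℤᵇ {r} {t} with t ≤ℤᵇ r in e
... | true  = mk⇔ (λ ()) (λ r<t → ℤ.<⇒≱ r<t (ℤ.≤ᵇ⇒≤ (from T-≡ e)))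
... | false = mk⇔ (λ _ → ℤ.≰⇒> (λ t≤r → subst T e (ℤ.≤⇒≤ᵇ t≤r))) (λ _ → _)

T-below : ∀ {c a r t} → T ((c ≡ᵇ a) ∧ (r <ℤᵇ t)) ⇔ (c ≡ a × r Z.< t)
T-below {c} {a} = mk⇔
  (λ h → let c≡ᵇa , r<t = to T-∧ h in ℕ.≡ᵇ⇒≡ c a c≡ᵇa , to T-<ℤᵇ r<t)
  (λ { (c≡a , r<t) → from T-∧ (ℕ.≡⇒≡ᵇ c a c≡a , from T-<ℤᵇ r<t) })

maxℤ-sel : ∀ r s → maxℤ r s ≡ r ⊎ maxℤ r s ≡ s
maxℤ-sel r s with r ≤ℤᵇ s
... | true  = inj₂ refl
... | false = inj₁ refl

maxℤ-bounds : ∀ r s → r Z.≤ maxℤ r s × s Z.≤ maxℤ r s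
maxℤ-bounds r s with r ≤ℤᵇ s in e
... | true  = ℤ.≤ᵇ⇒≤ (from T-≡ e) , ℤ.≤-refl
... | false = ℤ.≤-refl , ℤ.<⇒≤ (ℤ.≰⇒> (λ r≤s → subst T e (ℤ.≤⇒≤ᵇ r≤s)))

tau-isTau : ∀ P a t → IsTau P a t (tau P a t)
tau-isTau []            a t ()
tau-isTau ((c , r) ∷ P) a t with tau P a t | tau-isTau P a t
... | nothing | none with (c ≡ᵇ a) ∧ (r <ℤᵇ t) in e
...   | true with to (T-below {c} {a} {r} {t}) (from T-≡ e)
...     | refl , r<t = here refl , r<t , λ { (here refl) _ → ℤ.≤-refl
                                           ; (there r∈) r′<t → ⊥-elim (none r∈ r′<t) }
tau-isTau ((c , r) ∷ P) a t | nothing | none | false =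
  λ { (here refl) r<t → subst T e (from (T-below {c} {a} {r} {t}) (refl , r<t)) ; (there r∈) → none r∈ }
tau-isTau ((c , r) ∷ P) a t | just s | s∈ , s<t , maxs with (c ≡ᵇ a) ∧ (r <ℤᵇ t) in e
...   | true with to (T-below {c} {a} {r} {t}) (from T-≡ e)
...     | refl , r<t =
  max∈ , max<t , λ { (here refl) _ → proj₁ (maxℤ-bounds r s)
                   ; (there r′∈) r′<t → ℤ.≤-trans (maxs r′∈ r′<t) (proj₂ (maxℤ-bounds r s)) }
  where
  max∈ : (c , maxℤ r s) ∈ (c , r) ∷ P
  max∈ with maxℤ-sel r s
  ... | inj₁ m≡r = here (cong (c ,_) m≡r)
  ... | inj₂ m≡s = there (subst (λ m → (c , m) ∈ P) (sym m≡s) s∈)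
  max<t : maxℤ r s Z.< t
  max<t with maxℤ-sel r s
  ... | inj₁ m≡r = subst (Z._< t) (sym m≡r) r<t
  ... | inj₂ m≡s = subst (Z._< t) (sym m≡s) s<t
tau-isTau ((c , r) ∷ P) a t | just s | s∈ , s<t , maxs | false =
  there s∈ , s<t , λ { (here refl) r<t → ⊥-elim (subst T e (from (T-below {c} {a} {r} {t}) (refl , r<t)))
                     ; (there r∈) → maxs r∈ }

IsTau-unique : ∀ {P a t m m′} → IsTau P a t m → IsTau P a t m′ → m ≡ m′
IsTau-unique {m = nothing} {nothing} _ _ = refl
IsTau-unique {m = nothing} {just s′} none (s′∈ , s′<t , _) = ⊥-elim (none s′∈ s′<t)
IsTau-unique {m = just s}  {nothing} (s∈ , s<t , _) none = ⊥-elim (none s∈ s<t)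
IsTau-unique {m = just s}  {just s′} (s∈ , s<t , maxs) (s′∈ , s′<t , maxs′) =
  cong just (ℤ.≤-antisym (maxs′ s∈ s<t) (maxs s′∈ s′<t))

IsTau-resp : ∀ {P Q a t} m → (∀ {r} → (a , r) ∈ P ⇔ (a , r) ∈ Q) → IsTau P a t m → IsTau Q a t m
IsTau-resp nothing  P⇔Q none = none ∘ from P⇔Q
IsTau-resp (just s) P⇔Q (s∈ , s<t , maxs) = to P⇔Q s∈ , s<t , maxs ∘ from P⇔Q

tau-cong : ∀ {P Q a t} → (∀ {r} → (a , r) ∈ P ⇔ (a , r) ∈ Q) → tau P a t ≡ tau Q a t
tau-cong {P} {Q} {a} {t} P⇔Q = IsTau-unique (IsTau-resp (tau P a t) P⇔Q (tau-isTau P a t)) (tau-isTau Q a t)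

T-allB : ∀ {A : Set} {p : A → Bool} xs → T (allB p xs) ⇔ (∀ {y} → y ∈ xs → T (p y))
T-allB []       = mk⇔ (λ _ ()) (λ _ → _)
T-allB (x ∷ xs) = mk⇔
  (λ h → let px , pxs = to T-∧ h in λ { (here refl) → px ; (there y∈) → to (T-allB xs) pxs y∈ })
  (λ h → from T-∧ (h (here refl) , from (T-allB xs) (λ y∈ → h (there y∈))))

T-samePt : ∀ {p q} → T (samePt p q) ⇔ p ≡ q
T-samePt {c , r} {c′ , r′} = mk⇔
  (λ h → let c≡ , r≡ = to (T-∧ {c ≡ᵇ c′} {r ≡ℤᵇ r′}) h
             r≤ , r≥ = to (T-∧ {r ≤ℤᵇ r′}) r≡ in
    cong₂ _,_ (ℕ.≡ᵇ⇒≡ c c′ c≡) (ℤ.≤-antisym (ℤ.≤ᵇ⇒≤ r≤) (ℤ.≤ᵇ⇒≤ r≥)))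
  (λ { refl → from T-∧ (ℕ.≡⇒≡ᵇ c c refl ,
                         from (T-∧ {r ≤ℤᵇ r}) (ℤ.≤⇒≤ᵇ (ℤ.≤-refl {r}) , ℤ.≤⇒≤ᵇ (ℤ.≤-refl {r}))) })

T-inRect : ∀ {a s x t c r} → T (inRect a s x t (c , r)) ⇔ ((a ⊓ x ≤ c × c ≤ a ⊔ x) × s Z.≤ r × r Z.≤ t)
T-inRect {a} {s} {x} {t} {c} {r} = mk⇔
  (λ h → let h₁ , h′ = to T-∧ h ; h₂ , h″ = to T-∧ h′ ; h₃ , h₄ = to T-∧ h″ in
    (ℕ.≤ᵇ⇒≤ _ _ h₁ , ℕ.≤ᵇ⇒≤ _ _ h₂) , ℤ.≤ᵇ⇒≤ h₃ , ℤ.≤ᵇ⇒≤ h₄)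
  (λ { ((h₁ , h₂) , h₃ , h₄) →
         from T-∧ (ℕ.≤⇒≤ᵇ h₁ , from T-∧ (ℕ.≤⇒≤ᵇ h₂ , from T-∧ (ℤ.≤⇒≤ᵇ h₃ , ℤ.≤⇒≤ᵇ h₄))) })

IsTau-of : ∀ {P a t m} → tau P a t ≡ m → IsTau P a t m
IsTau-of {P} {a} {t} τ≡ = subst (IsTau P a t) τ≡ (tau-isTau P a t)

CornersOnly : List Point → ℕ → ℤ → ℕ → ℤ → Set
CornersOnly L a s x t = ∀ {p} → p ∈ L → T (inRect a s x t p) → p ≡ (a , s) ⊎ p ≡ (x , t)

T-cornerTest : ∀ {a s x t} p →
  T (not (inRect a s x t p) ∨ samePt p (a , s) ∨ samePt p (x , t)) ⇔
  (T (inRect a s x t p) → p ≡ (a , s) ⊎ p ≡ (x , t))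
T-cornerTest {a} {s} {x} {t} p with inRect a s x t p
... | false = mk⇔ (λ _ ()) (λ _ → _)
... | true  = mk⇔ (λ h _ → Sum.map (to T-samePt) (to T-samePt) (to T-∨ h))
                  (λ h → from T-∨ (Sum.map (from T-samePt) (from T-samePt) (h _)))

T-touched : ∀ {P x t a} → T (touched P x t a) ⇔ (∃ λ s → tau P a t ≡ just s × CornersOnly ((x , t) ∷ P) a s x t)
T-touched {P} {x} {t} {a} with tau P a t
... | nothing = mk⇔ (λ ()) (λ { (_ , () , _) })
... | just s  = mk⇔ (λ h → s , refl , λ {p} p∈ → to (T-cornerTest p) (to (T-allB _) h p∈))
                    (λ { (_ , refl , corners) → from (T-allB _) (λ {p} p∈ → from (T-cornerTest p) (corners p∈)) })

AgreeOn : (ℕ → Set) → List Point → List Point → Set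
AgreeOn C P Q = ∀ {c r} → C c → (c , r) ∈ P ⇔ (c , r) ∈ Q

RowsBelow : ℤ → List Point → Set
RowsBelow t P = ∀ {c r} → (c , r) ∈ P → r Z.< t

touched-cong : ∀ {P Q x t a} → AgreeOn (λ c → a ⊓ x ≤ c × c ≤ a ⊔ x) P Q → touched P x t a ≡ touched Q x t a
touched-cong {x = x} {t} {a} P≈Q = T-injective (transfer P≈Q) (transfer (⇔.sym ∘ P≈Q))
  where
  transfer : ∀ {P Q} → AgreeOn (λ c → a ⊓ x ≤ c × c ≤ a ⊔ x) P Q → T (touched P x t a) → T (touched Q x t a)
  transfer {P} {Q} P≈Q h with to T-touched h
  ... | s , τ≡ , corners =
    from T-touched (s , trans (sym (tau-cong (P≈Q (ℕ.m⊓n≤m a x , ℕ.m≤m⊔n a x)))) τ≡ , corners′)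
    where
    corners′ : CornersOnly ((x , t) ∷ Q) a s x t
    corners′ (here refl) inR = corners (here refl) inR
    corners′ {c , r} (there p∈) inR =
      corners (there (from (P≈Q (proj₁ (to (T-inRect {a} {s} {x} {t} {c} {r}) inR))) p∈)) inR

touched-self : ∀ {P k t r₀} → (k , r₀) ∈ P → RowsBelow t P → T (touched P k t k)
touched-self {P} {k} {t} k∈P below = from T-touched (witness (tau P k t) refl)
  where
  witness : ∀ m → tau P k t ≡ m → ∃ λ s → tau P k t ≡ just s × CornersOnly ((k , t) ∷ P) k s k t
  witness nothing  τ≡ = ⊥-elim (IsTau-of τ≡ k∈P (below k∈P))
  witness (just s) τ≡ = s , τ≡ , corners
    where
    corners : CornersOnly ((k , t) ∷ P) k s k t
    corners (here refl) _ = inj₂ refl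
    corners {c , r} (there p∈) inR with to (T-inRect {k} {s} {k} {t} {c} {r}) inR
    ... | (k⊓k≤c , c≤k⊔k) , s≤r , _
      with ℕ.≤-antisym (subst (_≤ c) (ℕ.⊓-idem k) k⊓k≤c) (subst (c ≤_) (ℕ.⊔-idem k) c≤k⊔k)
    ...   | refl = inj₁ (cong (k ,_) (ℤ.≤-antisym (proj₂ (proj₂ (IsTau-of τ≡)) p∈ (below p∈)) s≤r))

between-⊓-⊔ : ∀ {x k c} → x < k → k < c → c ⊓ x ≤ k × k ≤ c ⊔ x
between-⊓-⊔ x<k k<c =
  subst (_≤ _) (sym (ℕ.m≥n⇒m⊓n≡n x≤c)) (ℕ.<⇒≤ x<k) , subst (_ ≤_) (sym (ℕ.m≥n⇒m⊔n≡m x≤c)) (ℕ.<⇒≤ k<c)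
  where x≤c = ℕ.<⇒≤ (ℕ.<-trans x<k k<c)

-- a point (k , w) standing between x and c blocks the rectangle from (c , τ(c,t)) to (x , t)
touched-blocked : ∀ {P x t c k w} → x < k → k < c → (k , w) ∈ P →
  (∀ {r} → (c , r) ∈ P → r Z.≤ w) → w Z.< t → ¬ T (touched P x t c)
touched-blocked {P} {x} {t} {c} {k} {w} x<k k<c k∈P column≤w w<t h with to T-touched h
... | s , τ≡ , corners
  with corners (there k∈P) (from (T-inRect {c} {s} {x} {t} {k} {w})
                                 (between-⊓-⊔ x<k k<c , column≤w (proj₁ (IsTau-of τ≡)) , ℤ.<⇒≤ w<t))
...   | inj₁ k≡c = ℕ.<⇒≢ k<c (,-injectiveˡ k≡c)
...   | inj₂ k≡x = ℕ.<⇒≢ x<k (sym (,-injectiveˡ k≡x))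

newPoints : (ℕ → List ℕ) → List Point → ℕ → ℕ → List Point
newPoints cand P t x = map (λ a → (a , + t)) (filterᵇ (touched P x (+ t)) (cand x))

finalPoints : (ℕ → List ℕ) → List Point → ℕ → List ℕ → List Point
finalPoints cand P t []       = P
finalPoints cand P t (x ∷ xs) = finalPoints cand (newPoints cand P t x ++ P) (suc t) xs

run-++ : ∀ cand P t xs ys →
  run cand P t (xs ++ ys) ≡ run cand P t xs ++ run cand (finalPoints cand P t xs) (t + length xs) ys
run-++ cand P t []       ys = cong (λ t′ → run cand P t′ ys) (sym (+-identityʳ t))
run-++ cand P t (x ∷ xs) ys = begin
  new ++ run cand (new ++ P) (suc t) (xs ++ ys)
    ≡⟨ cong (new ++_) (run-++ cand (new ++ P) (suc t) xs ys) ⟩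
  new ++ (run cand (new ++ P) (suc t) xs ++ run cand final (suc t + length xs) ys)
    ≡⟨ sym (++-assoc new _ _) ⟩
  (new ++ run cand (new ++ P) (suc t) xs) ++ run cand final (suc t + length xs) ys
    ≡⟨ cong (λ t′ → (new ++ run cand (new ++ P) (suc t) xs) ++ run cand final t′ ys) (sym (+-suc t (length xs))) ⟩
  (new ++ run cand (new ++ P) (suc t) xs) ++ run cand final (t + suc (length xs)) ys ∎
  where
  open ≡-Reasoning
  new = newPoints cand P t x
  final = finalPoints cand (new ++ P) (suc t) xs

∈-newPoints⇔ : ∀ cand P t x {c r} →
  (c , r) ∈ newPoints cand P t x ⇔ (r ≡ + t × c ∈ cand x × T (touched P x (+ t) c))
∈-newPoints⇔ cand P t x = mk⇔
  (λ p∈ → case ∈-map⁻ _ p∈ of λ { (c , c∈ , refl) →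
            let c∈cand , h = ∈-filter⁻ (T? ∘ touched P x (+ t)) c∈ in refl , c∈cand , h })
  (λ { (refl , c∈cand , h) → ∈-map⁺ _ (∈-filter⁺ (T? ∘ touched P x (+ t)) c∈cand h) })

∈-finalPoints⁺ : ∀ {cand P t p} xs → p ∈ P → p ∈ finalPoints cand P t xs
∈-finalPoints⁺ []       p∈ = p∈
∈-finalPoints⁺ (x ∷ xs) p∈ = ∈-finalPoints⁺ xs (∈-++⁺ʳ _ p∈)

∈-finalPoints⁻ : ∀ {cand P t p} xs → p ∈ finalPoints cand P t xs → p ∈ P ⊎ p ∈ run cand P t xs
∈-finalPoints⁻ []       p∈ = inj₁ p∈
∈-finalPoints⁻ {cand} {P} {t} (x ∷ xs) p∈ with ∈-finalPoints⁻ xs p∈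
... | inj₂ p∈run = inj₂ (∈-++⁺ʳ (newPoints cand P t x) p∈run)
... | inj₁ p∈′ with ∈-++⁻ (newPoints cand P t x) p∈′
...   | inj₁ p∈new = inj₂ (∈-++⁺ˡ p∈new)
...   | inj₂ p∈P   = inj₁ p∈P

rowsBelow-step : ∀ {cand P t x} → RowsBelow (+ t) P → RowsBelow (+ suc t) (newPoints cand P t x ++ P)
rowsBelow-step {cand} {P} {t} {x} below p∈ with ∈-++⁻ (newPoints cand P t x) p∈
... | inj₁ p∈new with to (∈-newPoints⇔ cand P t x) p∈new
...   | refl , _ = Z.+<+ (ℕ.n<1+n t)
rowsBelow-step below p∈ | inj₂ p∈P = ℤ.<-trans (below p∈P) (Z.+<+ (ℕ.n<1+n _))

rowsBelow-final : ∀ {cand P t} xs → RowsBelow (+ t) P → RowsBelow (+ (t + length xs)) (finalPoints cand P t xs)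
rowsBelow-final {t = t} [] below = subst (λ t′ → RowsBelow (+ t′) _) (sym (+-identityʳ t)) below
rowsBelow-final {cand} {P} {t} (x ∷ xs) below =
  subst (λ t′ → RowsBelow (+ t′) (finalPoints cand P t (x ∷ xs))) (sym (+-suc t (length xs)))
    (rowsBelow-final xs (rowsBelow-step {cand} {P} {t} {x} below))

run-columns : ∀ {cand P t c r} xs → (c , r) ∈ run cand P t xs → ∃ λ x → x ∈ xs × c ∈ cand x
run-columns {cand} {P} {t} (x ∷ xs) p∈ with ∈-++⁻ (newPoints cand P t x) p∈
... | inj₁ p∈new = x , here refl , proj₁ (proj₂ (to (∈-newPoints⇔ cand P t x) p∈new))
... | inj₂ p∈run = let y , y∈ , c∈ = run-columns xs p∈run in y , there y∈ , c∈

newPoints-columns-≤ : ∀ {cand P t x k w c r} → x < k → (k , w) ∈ P →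
  (∀ {c r} → k < c → (c , r) ∈ P → r Z.≤ w) → w Z.< + t → (c , r) ∈ newPoints cand P t x → c ≤ k
newPoints-columns-≤ {cand} {P} {t} {x} {k} {c = c} x<k k∈P right≤w w<t p∈ with c ℕ.≤? k
... | yes c≤k = c≤k
... | no  c≰k =
  ⊥-elim (touched-blocked x<k k<c k∈P (right≤w k<c) w<t (proj₂ (proj₂ (to (∈-newPoints⇔ cand P t x) p∈))))
  where k<c = ℕ.≰⇒> c≰k

-- Invariant: (k , w) lies above every point right of k; it is kept because by
-- touched-blocked no new point lands right of k.
run-columns-≤ : ∀ {cand P t k w} xs → All (_< k) xs → (k , w) ∈ P →
  (∀ {c r} → k < c → (c , r) ∈ P → r Z.≤ w) → RowsBelow (+ t) P →
  ∀ {c r} → (c , r) ∈ run cand P t xs → c ≤ k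
run-columns-≤ {cand} {P} {t} {k} {w} (x ∷ xs) (x<k ∷ xs<k) k∈P right≤w below p∈
  with ∈-++⁻ (newPoints cand P t x) p∈
... | inj₁ p∈new = newPoints-columns-≤ {cand} {P} {t} {x} x<k k∈P right≤w (below k∈P) p∈new
... | inj₂ p∈run =
  run-columns-≤ xs xs<k (∈-++⁺ʳ _ k∈P) right≤w′ (rowsBelow-step {cand} {P} {t} {x} below) p∈run
  where
  right≤w′ : ∀ {c r} → k < c → (c , r) ∈ newPoints cand P t x ++ P → r Z.≤ w
  right≤w′ k<c q∈ with ∈-++⁻ (newPoints cand P t x) q∈
  ... | inj₁ q∈new =
    ⊥-elim (ℕ.<⇒≱ k<c (newPoints-columns-≤ {cand} {P} {t} {x} x<k k∈P right≤w (below k∈P) q∈new))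
  ... | inj₂ q∈P   = right≤w k<c q∈P

length-run-∷-++ : ∀ cand P t x xs ys → let P′ = newPoints cand P t x ++ P in
  length (run cand P t (x ∷ xs ++ ys)) ≡
  length (newPoints cand P t x) + (length (run cand P′ (suc t) xs)
                                   + length (run cand (finalPoints cand P′ (suc t) xs) (suc t + length xs) ys))
length-run-∷-++ cand P t x xs ys =
  trans (length-++ (newPoints cand P t x))
        (cong (λ n → length (newPoints cand P t x) + n)
              (trans (cong length (run-++ cand _ (suc t) xs ys)) (length-++ (run cand _ (suc t) xs))))

seg-convex : ∀ {lo m a x c} → a ∈ seg lo m → x ∈ seg lo m → a ⊓ x ≤ c × c ≤ a ⊔ x → c ∈ seg lo m
seg-convex a∈ x∈ (a⊓x≤c , c≤a⊔x) with to ∈-seg⇔ a∈ | to ∈-seg⇔ x∈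
... | lo≤a , a<hi | lo≤x , x<hi =
  from ∈-seg⇔ (ℕ.≤-trans (ℕ.⊓-glb lo≤a lo≤x) a⊓x≤c , ℕ.≤-<-trans c≤a⊔x (ℕ.⊔-lub a<hi x<hi))

agree-++ : ∀ {C P Q P′ Q′} → AgreeOn C P′ Q′ → AgreeOn C P Q → AgreeOn C (P′ ++ P) (Q′ ++ Q)
agree-++ {P′ = P′} {Q′} new old c∈ = mk⇔
  (Sum.[ ∈-++⁺ˡ ∘ to (new c∈) , ∈-++⁺ʳ Q′ ∘ to (old c∈) ] ∘ ∈-++⁻ P′)
  (Sum.[ ∈-++⁺ˡ ∘ from (new c∈) , ∈-++⁺ʳ P′ ∘ from (old c∈) ] ∘ ∈-++⁻ Q′)

Covers : List ℕ → List Point → Set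
Covers U P = ∀ {c} → c ∈ U → ∃ λ r → (c , r) ∈ P

∈-cand : ∀ {cand lo m S x c} (D : BST lo m S) → SubtreeIntervals cand D →
  x ∈ preorder S → c ∈ cand x → c ∈ seg lo m
∈-cand (node dl dr) (root , _ , _) (here refl) c∈ = subst (_ ∈_) root c∈
∈-cand {lo = lo} (node {a = a} {b} {l} dl dr) (_ , intsˡ , intsʳ) (there x∈) c∈ with ∈-++⁻ (preorder l) x∈
... | inj₁ x∈l = lookup (seg-⊆ˡ lo a b) (∈-cand dl intsˡ x∈l c∈)
... | inj₂ x∈r = lookup (seg-⊆ʳ lo a b) (∈-cand dr intsʳ x∈r c∈)

agree-finalPoints : ∀ {C cand cand′ P Q t} xs → AgreeOn C P Q →
  (∀ {c r} → (c , r) ∈ run cand P t xs → ¬ C c) → (∀ {c r} → (c , r) ∈ run cand′ Q t xs → ¬ C c) →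
  AgreeOn C (finalPoints cand P t xs) (finalPoints cand′ Q t xs)
agree-finalPoints xs P≈Q avoidP avoidQ c∈ = mk⇔
  (Sum.[ ∈-finalPoints⁺ xs ∘ to (P≈Q c∈) , (λ p∈ → ⊥-elim (avoidP p∈ c∈)) ] ∘ ∈-finalPoints⁻ xs)
  (Sum.[ ∈-finalPoints⁺ xs ∘ from (P≈Q c∈) , (λ p∈ → ⊥-elim (avoidQ p∈ c∈)) ] ∘ ∈-finalPoints⁻ xs)

module _ (U : List ℕ) (cand : ℕ → List ℕ) {lo m t k : ℕ} {P Q : List Point}
         (cand≡ : cand k ≡ seg lo m) (I⊆U : seg lo m ⊆ U) (k∈I : k ∈ seg lo m)
         (P≈Q : AgreeOn (_∈ seg lo m) P Q) where

  touched-agree : ∀ {c} → c ∈ seg lo m → touched P k (+ t) c ≡ touched Q k (+ t) c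
  touched-agree c∈ = touched-cong (P≈Q ∘ seg-convex c∈ k∈I)

  newPoints-agree : AgreeOn (_∈ seg lo m) (newPoints (λ _ → U) P t k) (newPoints cand Q t k)
  newPoints-agree {c} c∈ = mk⇔
    (λ p∈ → let r≡ , _ , h = to (∈-newPoints⇔ (λ _ → U) P t k) p∈ in
      from (∈-newPoints⇔ cand Q t k) (r≡ , subst (c ∈_) (sym cand≡) c∈ , subst T (touched-agree c∈) h))
    (λ p∈ → let r≡ , _ , h = to (∈-newPoints⇔ cand Q t k) p∈ in
      from (∈-newPoints⇔ (λ _ → U) P t k) (r≡ , lookup I⊆U c∈ , subst T (sym (touched-agree c∈)) h))

  newPoints-length-≤ : length (newPoints cand Q t k) ≤ length (newPoints (λ _ → U) P t k)
  newPoints-length-≤ = begin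
    length (newPoints cand Q t k)
      ≡⟨ length-map _ (filterᵇ (touched Q k (+ t)) (cand k)) ⟩
    length (filterᵇ (touched Q k (+ t)) (cand k))
      ≡⟨ cong (length ∘ filterᵇ (touched Q k (+ t))) cand≡ ⟩
    length (filterᵇ (touched Q k (+ t)) (seg lo m))
      ≡⟨ cong length (filterᵇ-cong-∈ (seg lo m) (sym ∘ touched-agree)) ⟩
    length (filterᵇ (touched P k (+ t)) (seg lo m))
      ≤⟨ Sublist.length-mono-≤ (Sublist.filter⁺ _ _ (λ { refl → id }) I⊆U) ⟩
    length (filterᵇ (touched P k (+ t)) U)
      ≡⟨ length-map _ (filterᵇ (touched P k (+ t)) U) ⟨
    length (newPoints (λ _ → U) P t k) ∎
    where open ℕ.≤-Reasoning

simulation : ∀ U cand {lo m S} (D : BST lo m S) → SubtreeIntervals cand D → seg lo m ⊆ U →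
  ∀ {P Q} t → AgreeOn (_∈ seg lo m) P Q → RowsBelow (+ t) P → Covers U P →
  length (run cand Q t (preorder S)) ≤ length (run (λ _ → U) P t (preorder S))
simulation U cand leaf _ _ _ _ _ _ = z≤n
simulation U cand {lo} (node {a = a} {b} {l} {r} dl dr) (root , intsˡ , intsʳ) I⊆U {P} {Q} t P≈Q below covers =
  begin
    length (run cand Q t (k ∷ pl ++ pr))
      ≡⟨ length-run-∷-++ cand Q t k pl pr ⟩
    _ ≤⟨ ℕ.+-mono-≤ (newPoints-length-≤ U cand root I⊆U k∈I P≈Q) (ℕ.+-mono-≤ left right) ⟩
    _ ≡⟨ length-run-∷-++ full P t k pl pr ⟨
    length (run full P t (k ∷ pl ++ pr)) ∎
  where
  open ℕ.≤-Reasoning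
  full : ℕ → List ℕ
  full _ = U
  k = lo + a
  pl = preorder l
  pr = preorder r
  k∈I = split-∈-seg lo a b
  P₁ = newPoints full P t k ++ P
  Q₁ = newPoints cand Q t k ++ Q
  P₁≈Q₁ : AgreeOn (_∈ seg lo (suc (a + b))) P₁ Q₁
  P₁≈Q₁ = agree-++ (newPoints-agree U cand root I⊆U k∈I P≈Q) P≈Q
  below₁ : RowsBelow (+ suc t) P₁
  below₁ = rowsBelow-step {full} {P} {t} {k} below
  covers₁ : Covers U P₁
  covers₁ = map₂ (∈-++⁺ʳ _) ∘ covers
  left = simulation U cand dl intsˡ (⊆-trans (seg-⊆ˡ lo a b) I⊆U) (suc t)
    (P₁≈Q₁ ∘ lookup (seg-⊆ˡ lo a b)) below₁ covers₁
  -- (k , t) lies above everything right of k, which confines the full run of the left subtree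
  k∈P₁ : (k , + t) ∈ P₁
  k∈P₁ = ∈-++⁺ˡ (from (∈-newPoints⇔ full P t k)
    (refl , lookup I⊆U k∈I , touched-self (proj₂ (covers (lookup I⊆U k∈I))) below))
  fullˡ-columns : ∀ {c r} → (c , r) ∈ run full P₁ (suc t) pl → c ≤ k
  fullˡ-columns = run-columns-≤ pl (All.tabulate (λ x∈ → proj₂ (to ∈-seg⇔ (∈-preorder-BST dl x∈))))
    k∈P₁ (λ _ q∈ → ℤ.i<j⇒i≤pred[j] (below₁ q∈)) below₁
  splitˡ-columns : ∀ {c r} → (c , r) ∈ run cand Q₁ (suc t) pl → c < k
  splitˡ-columns p∈ = let _ , x∈ , c∈ = run-columns pl p∈ in proj₂ (to ∈-seg⇔ (∈-cand dl intsˡ x∈ c∈))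
  Pₗ≈Qₗ : AgreeOn (_∈ seg (suc k) b) (finalPoints full P₁ (suc t) pl) (finalPoints cand Q₁ (suc t) pl)
  Pₗ≈Qₗ = agree-finalPoints pl (P₁≈Q₁ ∘ lookup (seg-⊆ʳ lo a b))
    (λ p∈ c∈ → ℕ.<⇒≱ (proj₁ (to ∈-seg⇔ c∈)) (fullˡ-columns p∈))
    (λ p∈ c∈ → ℕ.<⇒≱ (proj₁ (to ∈-seg⇔ c∈)) (ℕ.<⇒≤ (splitˡ-columns p∈)))
  right = simulation U cand dr intsʳ (⊆-trans (seg-⊆ʳ lo a b) I⊆U) (suc t + length pl) Pₗ≈Qₗ
    (rowsBelow-final pl below₁) (map₂ (∈-finalPoints⁺ pl) ∘ covers₁)

inorder-depthPoints : ∀ T d {c} → c ∈ inorder T → ∃ λ r → (c , r) ∈ depthPoints d T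
inorder-depthPoints (node l k r) d c∈ with ∈-++⁻ (inorder l) c∈
... | inj₁ c∈l         = map₂ (there ∘ ∈-++⁺ˡ) (inorder-depthPoints l (suc d) c∈l)
... | inj₂ (here refl) = _ , here refl
... | inj₂ (there c∈r) = map₂ (there ∘ ∈-++⁺ʳ _) (inorder-depthPoints r (suc d) c∈r)

depthPoints-rows : ∀ T d → RowsBelow (+ 1) (depthPoints d T)
depthPoints-rows (node l k r) d (here refl) = ℤ.≤-<-trans ℤ.neg-≤-pos (Z.+<+ (s≤s z≤n))
depthPoints-rows (node l k r) d (there p∈) with ∈-++⁻ (depthPoints (suc d) l) p∈
... | inj₁ p∈l = depthPoints-rows l (suc d) p∈l
... | inj₂ p∈r = depthPoints-rows r (suc d) p∈r

mainTheorem10 : (n : ℕ) (X : List ℕ) (T : Tree) →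
    IsPreorderOfBST n X → IsBSTOn n T →
    length (greedySplit n X T) ≤ length (greedy n X T)
mainTheorem10 n X T (S , S-bst , refl) T-bst =
  simulation (keys n) (keysInI (preorder S)) D intervals (⊆-reflexive (sym (keys≡seg n)))
             1 (λ _ → ⇔.refl) (depthPoints-rows T 0) covers
  where
  D : BST 1 n S
  D = BST-inorder S (trans S-bst (keys≡seg n))
  intervals : SubtreeIntervals (keysInI (preorder S)) D
  intervals = subst (λ R → SubtreeIntervals (subtreeInterval R) D) (sym (bstOf-preorder D))
                    (subtreeInterval-intervals S D (λ _ → refl))
  covers : Covers (keys n) (initialPoints T)
  covers c∈ = inorder-depthPoints T 0 (subst (_ ∈_) (sym T-bst) c∈)
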